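{- Let $N_3(n)$ denote the number of pairwise non-isomorphic strong tricentral $2$-trees on $n$ vertices whose tail vertices all have degree in $\{2,3\}$ (over all possible maximum degrees). There exists an absolute constant $c>0$ such that $N_3(n)\ge c\,n^2$ for all sufficiently large $n$ with $n\equiv 0\pmod 3$. In particular, $N_3(n)\ge \left\lfloor \frac{(n-15)^2}{72}\right\rfloor$ for every $n\ge 24$ with $n\equiv 0\pmod 3$.
   Context: A $2$-tree is a graph obtained from the triangle $K_3$ by repeatedly adding a new vertex adjacent to both endpoints of an existing edge. For $r\in\{1,2,3\}$ and an integer $\Delta\ge 2$, a $2$-tree on $n$ vertices is $r$-central with maximum degree $\Delta$ if $\Delta$ is its maximum degree and exactly $r$ vertices have degree $\Delta$; these $r$ vertices form the core and the other $n-r$ vertices form the tail. It is strong if the core induces $K_r$. "Tricentral" means $3$-central. -}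

module Defs where

open import Data.Nat using (ℕ; zero; suc; _+_; _⊔_; _<_)
open import Data.Bool using (Bool; true; false; if_then_else_; not; _∨_)
open import Data.Fin using (Fin; zero; suc; _≟_)
open import Data.List using (List; map; allFin; foldr; length)
open import Data.Nat.ListAction using (sum)
open import Data.List.Relation.Unary.All using (All)
open import Data.List.Relation.Unary.AllPairs using (AllPairs)
open import Data.Product using (Σ; ∃; _×_)
open import Data.Sum using (_⊎_)
open import Function.Bundles using (_↔_; Inverse)
open import Relation.Nullary using (¬_; ⌊_⌋)
open import Relation.Binary.PropositionalEquality using (_≡_; _≢_)

Graph : ℕ → Set
Graph n = Fin n → Fin n → Bool

K3 : Graph 3
K3 i j = not ⌊ i ≟ j ⌋

-- Add a new vertex (numbered zero; old vertices shifted by suc)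
-- adjacent exactly to u and v.
addVertex : ∀ {n} → Graph n → Fin n → Fin n → Graph (suc n)
addVertex G u v zero    zero    = false
addVertex G u v zero    (suc j) = ⌊ j ≟ u ⌋ ∨ ⌊ j ≟ v ⌋
addVertex G u v (suc i) zero    = ⌊ i ≟ u ⌋ ∨ ⌊ i ≟ v ⌋
addVertex G u v (suc i) (suc j) = G i j

data Built : (n : ℕ) → Graph n → Set where
  base : Built 3 K3
  step : ∀ {n} {G : Graph n} (u v : Fin n) → Built n G → G u v ≡ true →
         Built (suc n) (addVertex G u v)

_≅_ : ∀ {n} → Graph n → Graph n → Set
_≅_ {n} G H = Σ (Fin n ↔ Fin n) λ σ →
  ∀ i j → G i j ≡ H (Inverse.to σ i) (Inverse.to σ j)

IsTwoTree : ∀ {n} → Graph n → Set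
IsTwoTree {n} H = Σ (Graph n) λ G → Built n G × (G ≅ H)

deg : ∀ {n} → Graph n → Fin n → ℕ
deg {n} G i = sum (map (λ j → if G i j then 1 else 0) (allFin n))

maxDeg : ∀ {n} → Graph n → ℕ
maxDeg {n} G = foldr _⊔_ 0 (map (deg G) (allFin n))

coreSize : ∀ {n} → Graph n → ℕ
coreSize {n} G =
  sum (map (λ i → if ⌊ deg G i Data.Nat.≟ maxDeg G ⌋ then 1 else 0) (allFin n))

StrongTricentral : ∀ {n} → Graph n → Set
StrongTricentral {n} G =
  coreSize G ≡ 3 ×
  (∀ i j → deg G i ≡ maxDeg G → deg G j ≡ maxDeg G → i ≢ j → G i j ≡ true)

TailDeg23 : ∀ {n} → Graph n → Set
TailDeg23 {n} G = ∀ i → deg G i ≢ maxDeg G → deg G i ≡ 2 ⊎ deg G i ≡ 3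

Good : ∀ {n} → Graph n → Set
Good G = IsTwoTree G × StrongTricentral G × TailDeg23 G

N3≥ : ℕ → ℕ → Set
N3≥ n k = Σ (List (Graph n)) λ L →
  length L ≡ k × All Good L × AllPairs (λ G H → ¬ (G ≅ H)) L

-- Start from a triangle abc and, at each of its three edges in turn (say ab), attach s leaves
-- (new vertices joined to a and b), t fans with two vertices and one fan with R + 2 vertices,
-- where a fan is a path of new vertices, all joined to a, whose first vertex is also joined to b.
-- With m = 3 + s + 2t + R the result is a 2-tree on 3m vertices whose tail vertices have degree
-- 2 or 3 while a, b, c all have degree m + s + t + 2, so it is strong tricentral. Its 3(s + t + 1)
-- vertices of degree 2 and, among them, the 3s with no neighbour of degree 3 are counted by
-- isomorphism invariants, so s < S and t < T with S + 2T = m give S T pairwise non-isomorphic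
-- graphs. Taking T = ⌊m / 4⌋ and S = m - 2T gives S T ≥ 2T² ≥ (m - 5)² / 8 = (3m - 15)² / 72.
module Submission where

open import Defs
open import Data.Nat using (ℕ; _*_; _∸_; _^_; _/_; _≤_; _≥_)
open import Data.Nat.Divisibility using (_∣_; divides)
open import Data.Product using (Σ; _×_)

open import Data.Bool using (Bool; true; false; if_then_else_; _∨_; _∧_; not)
open import Data.Bool.Properties using (∨-zeroʳ)
open import Data.Empty using (⊥-elim)
open import Data.Fin as Fin using (Fin; zero; suc; toℕ; punchIn)
open import Data.Fin.Properties using (suc-injective; punchInᵢ≢i; toℕ<n; toℕ-injective)
open import Data.List as List using (List; map; allFin; tabulate; length; take; cartesianProduct)
open import Data.List.Properties
  using (map-tabulate; foldr-preservesᵇ; foldr-preservesᵒ; length-map; length-tabulate; length-++; length-take)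
import Data.List.Relation.Unary.All as All
import Data.List.Relation.Unary.All.Properties as All
import Data.List.Relation.Unary.Any.Properties as Any
import Data.List.Relation.Unary.AllPairs as AllPairs
import Data.List.Relation.Unary.AllPairs.Properties as AllPairs
open import Data.List.Relation.Unary.Unique.Propositional.Properties using (cartesianProduct⁺; allFin⁺)
import Data.Nat as ℕ
open import Data.Nat using (zero; suc; _+_; _≡ᵇ_; s≤s; z≤n)
open import Data.Nat.DivMod using (_%_; m≡m%n+[m/n]*n; m%n<n; /-monoˡ-≤; m*n/n≡m; m≥n⇒m/n>0)
open import Data.Nat.ListAction using () renaming (sum to sumList)
open import Data.Nat.Properties
  using ( +-0-commutativeMonoid; ≤-antisym; ≤-reflexive; ≤-trans; <⇒≤; m≤m+n; m≤n+m; ⊔-lub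
        ; m≤n⇒m≤n⊔o; m≤n⇒m≤o⊔n; m≤n⇒m⊓n≡m; +-cancelˡ-≡; *-cancelʳ-≡; *-cancelʳ-≤; +-mono-≤; +-monoˡ-≤
        ; +-monoʳ-≤; *-mono-≤; *-monoˡ-≤; *-monoʳ-≤; ^-monoˡ-≤; *-distribʳ-∸; m+[n∸m]≡n; m≤n+o⇒m∸n≤o
        ; module ≤-Reasoning )
open import Data.Nat.Tactic.RingSolver using (solve-∀)
open import Data.Product using (_,_; ∃; proj₁; proj₂; uncurry)
open import Data.Sum as Sum using (_⊎_; inj₁; inj₂; [_,_])
open import Data.Vec.Functional using (_∷_; tail)
open import Function using (id; _∘_; _↔_; Inverse)
open import Function.Construct.Identity using (↔-id)
open import Relation.Binary.PropositionalEquality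
  using (_≡_; _≢_; refl; sym; trans; cong; cong₂; subst; module ≡-Reasoning)
open import Relation.Nullary using (¬_; Dec; ⌊_⌋; yes; no)
open import Relation.Nullary.Decidable using (isYes≗does; dec-true; dec-false)

open import Algebra.Properties.CommutativeMonoid.Sum +-0-commutativeMonoid
  using (sum-syntax; sum-cong-≗; sum-remove; sum-replicate-zero; ∑-distrib-+; sum-permute)

⌊⌋-yes : ∀ {p} {P : Set p} (P? : Dec P) → P → ⌊ P? ⌋ ≡ true
⌊⌋-yes P? p = trans (isYes≗does P?) (dec-true P? p)

⌊⌋-no : ∀ {p} {P : Set p} (P? : Dec P) → ¬ P → ⌊ P? ⌋ ≡ false
⌊⌋-no P? ¬p = trans (isYes≗does P?) (dec-false P? ¬p)

𝟙 : Bool → ℕ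
𝟙 b = if b then 1 else 0

sumList-tabulate : ∀ {n} (f : Fin n → ℕ) → sumList (tabulate f) ≡ ∑[ i < n ] f i
sumList-tabulate {zero}  f = refl
sumList-tabulate {suc n} f = cong (f zero +_) (sumList-tabulate (f ∘ suc))

sumList-allFin : ∀ {n} (f : Fin n → ℕ) → sumList (map f (allFin n)) ≡ ∑[ i < n ] f i
sumList-allFin {n} f = trans (cong sumList (map-tabulate {n = n} id f)) (sumList-tabulate f)

sum-zero : ∀ {n} {f : Fin n → ℕ} → (∀ i → f i ≡ 0) → ∑[ i < n ] f i ≡ 0
sum-zero {n} f≗0 = trans (sum-cong-≗ f≗0) (sum-replicate-zero n)

≤-sum : ∀ {n} (f : Fin n → ℕ) i → f i ≤ ∑[ j < n ] f j
≤-sum {suc n} f i = subst (f i ≤_) (sym (sum-remove f)) (m≤m+n (f i) _)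

sum-reindex : ∀ {n} (σ : Fin n ↔ Fin n) {f g : Fin n → ℕ} →
              (∀ i → f i ≡ g (Inverse.to σ i)) → ∑[ i < n ] f i ≡ ∑[ i < n ] g i
sum-reindex σ {g = g} f≗g∘σ = trans (sum-cong-≗ f≗g∘σ) (sym (sum-permute g σ))

sum-indicator : ∀ {n} (u : Fin n) → ∑[ j < n ] 𝟙 ⌊ j Fin.≟ u ⌋ ≡ 1
sum-indicator {suc n} u = begin
  ∑[ j < suc n ] 𝟙 ⌊ j Fin.≟ u ⌋                            ≡⟨ sum-remove (λ j → 𝟙 ⌊ j Fin.≟ u ⌋) ⟩
  𝟙 ⌊ u Fin.≟ u ⌋ + ∑[ j < n ] 𝟙 ⌊ punchIn u j Fin.≟ u ⌋   ≡⟨ cong₂ _+_ (cong 𝟙 (⌊⌋-yes (u Fin.≟ u) refl)) (sum-zero off-u) ⟩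
  1                                                         ∎
  where
  open ≡-Reasoning
  off-u : ∀ j → 𝟙 ⌊ punchIn u j Fin.≟ u ⌋ ≡ 0
  off-u j = cong 𝟙 (⌊⌋-no (punchIn u j Fin.≟ u) (punchInᵢ≢i u j))

deg≡sum : ∀ {n} (G : Graph n) i → deg G i ≡ ∑[ j < n ] 𝟙 (G i j)
deg≡sum G i = sumList-allFin (𝟙 ∘ G i)

module _ {n} (G : Graph n) (u v : Fin n) where

  addVertex-adj : ∀ i → addVertex G u v (suc i) zero ≡ true → i ≡ u ⊎ i ≡ v
  addVertex-adj i adj with i Fin.≟ u | i Fin.≟ v
  ... | yes i≡u | _       = inj₁ i≡u
  ... | no _    | yes i≡v = inj₂ i≡v
  ... | no _    | no _    with () ← adj

  addVertex-adj-u : addVertex G u v (suc u) zero ≡ true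
  addVertex-adj-u rewrite ⌊⌋-yes (u Fin.≟ u) refl = refl

  addVertex-adj-v : addVertex G u v (suc v) zero ≡ true
  addVertex-adj-v rewrite ⌊⌋-yes (v Fin.≟ v) refl = ∨-zeroʳ _

  deg-addVertex-old : ∀ i → deg (addVertex G u v) (suc i) ≡ 𝟙 (addVertex G u v (suc i) zero) + deg G i
  deg-addVertex-old i = trans (deg≡sum (addVertex G u v) (suc i)) (cong (_ +_) (sym (deg≡sum G i)))

  deg-addVertex-u : deg (addVertex G u v) (suc u) ≡ suc (deg G u)
  deg-addVertex-u = trans (deg-addVertex-old u) (cong (λ b → 𝟙 b + deg G u) addVertex-adj-u)

  deg-addVertex-v : deg (addVertex G u v) (suc v) ≡ suc (deg G v)
  deg-addVertex-v = trans (deg-addVertex-old v) (cong (λ b → 𝟙 b + deg G v) addVertex-adj-v)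

  deg-addVertex-other : ∀ {i} → i ≢ u → i ≢ v → deg (addVertex G u v) (suc i) ≡ deg G i
  deg-addVertex-other {i} i≢u i≢v = trans (deg-addVertex-old i)
    (cong (λ b → 𝟙 b + deg G i) (cong₂ _∨_ (⌊⌋-no (i Fin.≟ u) i≢u) (⌊⌋-no (i Fin.≟ v) i≢v)))

  deg-addVertex-new : u ≢ v → deg (addVertex G u v) zero ≡ 2
  deg-addVertex-new u≢v = begin
    deg (addVertex G u v) zero                               ≡⟨ deg≡sum (addVertex G u v) zero ⟩
    ∑[ j < n ] 𝟙 (⌊ j Fin.≟ u ⌋ ∨ ⌊ j Fin.≟ v ⌋)             ≡⟨ sum-cong-≗ 𝟙-∨ ⟩
    ∑[ j < n ] (𝟙 ⌊ j Fin.≟ u ⌋ + 𝟙 ⌊ j Fin.≟ v ⌋)           ≡⟨ ∑-distrib-+ (λ j → 𝟙 ⌊ j Fin.≟ u ⌋) (λ j → 𝟙 ⌊ j Fin.≟ v ⌋) ⟩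
    ∑[ j < n ] 𝟙 ⌊ j Fin.≟ u ⌋ + ∑[ j < n ] 𝟙 ⌊ j Fin.≟ v ⌋  ≡⟨ cong₂ _+_ (sum-indicator u) (sum-indicator v) ⟩
    2                                                        ∎
    where
    open ≡-Reasoning
    𝟙-∨ : ∀ j → 𝟙 (⌊ j Fin.≟ u ⌋ ∨ ⌊ j Fin.≟ v ⌋) ≡ 𝟙 ⌊ j Fin.≟ u ⌋ + 𝟙 ⌊ j Fin.≟ v ⌋
    𝟙-∨ j with j Fin.≟ u | j Fin.≟ v
    ... | yes refl | yes refl = ⊥-elim (u≢v refl)
    ... | yes _    | no _     = refl
    ... | no _     | _        = refl

maxDeg-attained : ∀ {n} (G : Graph n) {Δ} → (∀ j → deg G j ≤ Δ) → ∀ i → deg G i ≡ Δ → maxDeg G ≡ Δ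
maxDeg-attained {n} G {Δ} deg≤Δ i degᵢ≡Δ rewrite map-tabulate {n = n} id (deg G) = ≤-antisym
  (foldr-preservesᵇ {P = _≤ Δ} ⊔-lub z≤n (All.tabulate⁺ deg≤Δ))
  (foldr-preservesᵒ {P = Δ ≤_} (λ x y → [ m≤n⇒m≤n⊔o y , m≤n⇒m≤o⊔n x ]) 0 _
    (inj₂ (Any.tabulate⁺ i (≤-reflexive (sym degᵢ≡Δ)))))

deg2Count : ∀ {n} → Graph n → ℕ
deg2Count {n} G = ∑[ i < n ] 𝟙 (deg G i ≡ᵇ 2)

deg3Neighbours : ∀ {n} → Graph n → Fin n → ℕ
deg3Neighbours {n} G i = ∑[ j < n ] 𝟙 (G i j ∧ (deg G j ≡ᵇ 3))

leafCount : ∀ {n} → Graph n → ℕ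
leafCount {n} G = ∑[ i < n ] 𝟙 ((deg G i ≡ᵇ 2) ∧ (deg3Neighbours G i ≡ᵇ 0))

module _ {n} {G H : Graph n} (iso : G ≅ H) where
  private
    σ = proj₁ iso
    π = Inverse.to σ
    G≈H = proj₂ iso

  deg-≅ : ∀ i → deg G i ≡ deg H (π i)
  deg-≅ i = trans (deg≡sum G i) (trans (sum-reindex σ (λ j → cong 𝟙 (G≈H i j))) (sym (deg≡sum H (π i))))

  deg3Neighbours-≅ : ∀ i → deg3Neighbours G i ≡ deg3Neighbours H (π i)
  deg3Neighbours-≅ i = sum-reindex σ (λ j → cong₂ (λ x d → 𝟙 (x ∧ (d ≡ᵇ 3))) (G≈H i j) (deg-≅ j))

  deg2Count-≅ : deg2Count G ≡ deg2Count H
  deg2Count-≅ = sum-reindex σ (λ i → cong (λ d → 𝟙 (d ≡ᵇ 2)) (deg-≅ i))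

  leafCount-≅ : leafCount G ≡ leafCount H
  leafCount-≅ = sum-reindex σ (λ i → cong₂ (λ d e → 𝟙 ((d ≡ᵇ 2) ∧ (e ≡ᵇ 0))) (deg-≅ i) (deg3Neighbours-≅ i))

-- A leaf has degree 2 and both neighbours in the core; a fan consists of mid vertices of
-- degree 3 and a final tip of degree 2.
data Role : Set where
  core mid leaf tip : Role

δ : Role → Role → ℕ
δ core core = 1
δ mid  mid  = 1
δ leaf leaf = 1
δ tip  tip  = 1
δ _    _    = 0

count : ∀ {n} → Role → (Fin n → Role) → ℕ
count {n} r role = ∑[ i < n ] δ r (role i)

tailDegree : Role → ℕ
tailDegree core = 0
tailDegree mid  = 3
tailDegree leaf = 2
tailDegree tip  = 2

data Degree2 : Role → Set where
  leaf : Degree2 leaf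
  tip  : Degree2 tip

degree2≢core : ∀ {r} → Degree2 r → r ≢ core
degree2≢core leaf ()
degree2≢core tip  ()

tailDegree-degree2 : ∀ {r} → Degree2 r → tailDegree r ≡ 2
tailDegree-degree2 leaf = refl
tailDegree-degree2 tip  = refl

δ-core-degree2 : ∀ {r} → Degree2 r → δ core r ≡ 0
δ-core-degree2 leaf = refl
δ-core-degree2 tip  = refl

record Labelling {n} (G : Graph n) (a b c : Fin n) (role : Fin n → Role) : Set where
  field
    built    : Built n G
    a≢b      : a ≢ b
    b≢c      : b ≢ c
    c≢a      : c ≢ a
    role-a   : role a ≡ core
    role-b   : role b ≡ core
    role-c   : role c ≡ core
    core-abc : ∀ i → role i ≡ core → i ≡ a ⊎ i ≡ b ⊎ i ≡ c
    core-adj : ∀ i j → role i ≡ core → role j ≡ core → i ≢ j → G i j ≡ true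
    tail-deg : ∀ i → role i ≢ core → deg G i ≡ tailDegree (role i)
    leaf-adj : ∀ i j → role i ≡ leaf → G i j ≡ true → role j ≡ core
    tip-adj  : ∀ i → role i ≡ tip → ∃ λ j → G i j ≡ true × role j ≡ mid

  tail≢core : ∀ {i x} → role i ≢ core → role x ≡ core → i ≢ x
  tail≢core roleᵢ≢core roleₓ refl = roleᵢ≢core roleₓ

  tail-deg-≡ : ∀ {i r} → role i ≡ r → r ≢ core → deg G i ≡ tailDegree r
  tail-deg-≡ refl = tail-deg _

Labelling-K3 : Labelling K3 zero (suc zero) (suc (suc zero)) (λ _ → core)
Labelling-K3 = record
  { built = base
  ; a≢b = λ () ; b≢c = λ () ; c≢a = λ ()
  ; role-a = refl ; role-b = refl ; role-c = refl
  ; core-abc = λ { zero _ → inj₁ refl ; (suc zero) _ → inj₂ (inj₁ refl) ; (suc (suc zero)) _ → inj₂ (inj₂ refl) }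
  ; core-adj = λ i j _ _ i≢j → cong not (⌊⌋-no (i Fin.≟ j) i≢j)
  ; tail-deg = λ _ ≢core → ⊥-elim (≢core refl)
  ; leaf-adj = λ _ _ ()
  ; tip-adj  = λ _ ()
  }

Labelling-rotate : ∀ {n} {G : Graph n} {a b c role} → Labelling G a b c role → Labelling G b c a role
Labelling-rotate ℓ = record
  { built = built
  ; a≢b = b≢c ; b≢c = c≢a ; c≢a = a≢b
  ; role-a = role-b ; role-b = role-c ; role-c = role-a
  ; core-abc = λ i r → [ inj₂ ∘ inj₂ , Sum.map₂ inj₁ ] (core-abc i r)
  ; core-adj = core-adj
  ; tail-deg = tail-deg
  ; leaf-adj = leaf-adj
  ; tip-adj  = tip-adj
  }
  where open Labelling ℓ

module AddLeaf {n} {G : Graph n} {a b c role} (ℓ : Labelling G a b c role) where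
  open Labelling ℓ
  private
    G′ = addVertex G a b
    role′ = leaf ∷ role

  tail-deg′ : ∀ i → role′ i ≢ core → deg G′ i ≡ tailDegree (role′ i)
  tail-deg′ zero    _  = deg-addVertex-new G a b a≢b
  tail-deg′ (suc i) ri = trans (deg-addVertex-other G a b (tail≢core ri role-a) (tail≢core ri role-b)) (tail-deg i ri)

  leaf-adj′ : ∀ i j → role′ i ≡ leaf → G′ i j ≡ true → role′ j ≡ core
  leaf-adj′ zero    (suc j) _  j~0 = [ (λ { refl → role-a }) , (λ { refl → role-b }) ] (addVertex-adj G a b j j~0)
  leaf-adj′ (suc i) zero    ri i~0 with addVertex-adj G a b i i~0
  ... | inj₁ refl = ⊥-elim (degree2≢core leaf (trans (sym ri) role-a))
  ... | inj₂ refl = ⊥-elim (degree2≢core leaf (trans (sym ri) role-b))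
  leaf-adj′ (suc i) (suc j) ri i~j = leaf-adj i j ri i~j

  labelling : Labelling G′ (suc a) (suc b) (suc c) role′
  labelling = record
    { built = step a b built (core-adj a b role-a role-b a≢b)
    ; a≢b = a≢b ∘ suc-injective ; b≢c = b≢c ∘ suc-injective ; c≢a = c≢a ∘ suc-injective
    ; role-a = role-a ; role-b = role-b ; role-c = role-c
    ; core-abc = λ { (suc i) r → Sum.map (cong suc) (Sum.map (cong suc) (cong suc)) (core-abc i r) }
    ; core-adj = λ { (suc i) (suc j) ri rj i≢j → core-adj i j ri rj (i≢j ∘ cong suc) }
    ; tail-deg = tail-deg′
    ; leaf-adj = leaf-adj′
    ; tip-adj  = λ { (suc i) r → let j , i~j , rj = tip-adj i r in suc j , i~j , rj }
    }

module Extend {n} {G : Graph (suc n)} {a b c role r} (ℓ : Labelling G a b c role)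
              (role₀ : role zero ≡ r) (two : Degree2 r) (a~0 : G a zero ≡ true) where
  open Labelling ℓ
  private
    G′ = addVertex G a zero
    role′ = tip ∷ mid ∷ tail role

  role₀≢core : role zero ≢ core
  role₀≢core = degree2≢core two ∘ trans (sym role₀)

  kept-core : ∀ {i} → role i ≡ core → role′ (suc i) ≡ core
  kept-core {zero}  ri = ⊥-elim (role₀≢core ri)
  kept-core {suc i} ri = ri

  was-core : ∀ i → role′ (suc i) ≡ core → role i ≡ core
  was-core (suc i) ri = ri

  tail-deg′ : ∀ i → role′ i ≢ core → deg G′ i ≡ tailDegree (role′ i)
  tail-deg′ zero          _  = deg-addVertex-new G a zero (tail≢core role₀≢core role-a ∘ sym)
  tail-deg′ (suc zero)    _  = trans (deg-addVertex-v G a zero)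
    (cong suc (trans (tail-deg-≡ role₀ (degree2≢core two)) (tailDegree-degree2 two)))
  tail-deg′ (suc (suc i)) ri = trans (deg-addVertex-other G a zero (tail≢core ri role-a) λ ()) (tail-deg (suc i) ri)

  leaf-adj′ : ∀ i j → role′ i ≡ leaf → G′ i j ≡ true → role′ j ≡ core
  leaf-adj′ (suc (suc i)) zero    ri i~0 with addVertex-adj G a zero (suc i) i~0
  ... | inj₁ refl = ⊥-elim (degree2≢core leaf (trans (sym ri) role-a))
  leaf-adj′ (suc (suc i)) (suc j) ri i~j = kept-core (leaf-adj (suc i) j ri i~j)

  tip-adj′ : ∀ i → role′ i ≡ tip → ∃ λ j → G′ i j ≡ true × role′ j ≡ mid
  tip-adj′ zero          _  = suc zero , addVertex-adj-v G a zero , refl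
  tip-adj′ (suc (suc i)) ri with tip-adj (suc i) ri
  ... | zero  , i~j , _  = suc zero , i~j , refl
  ... | suc j , i~j , rj = suc (suc j) , i~j , rj

  labelling : Labelling G′ (suc a) (suc b) (suc c) role′
  labelling = record
    { built = step a zero built a~0
    ; a≢b = a≢b ∘ suc-injective ; b≢c = b≢c ∘ suc-injective ; c≢a = c≢a ∘ suc-injective
    ; role-a = kept-core role-a ; role-b = kept-core role-b ; role-c = kept-core role-c
    ; core-abc = λ { (suc i) r → Sum.map (cong suc) (Sum.map (cong suc) (cong suc)) (core-abc i (was-core i r)) }
    ; core-adj = λ { (suc i) (suc j) ri rj i≢j → core-adj i j (was-core i ri) (was-core j rj) (i≢j ∘ cong suc) }
    ; tail-deg = tail-deg′
    ; leaf-adj = leaf-adj′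
    ; tip-adj  = tip-adj′
    }

record Stage (n da db dc L T : ℕ) : Set where
  field
    graph     : Graph n
    a b c     : Fin n
    role      : Fin n → Role
    labelling : Labelling graph a b c role
    deg-a     : deg graph a ≡ da
    deg-b     : deg graph b ≡ db
    deg-c     : deg graph c ≡ dc
    #core     : count core role ≡ 3
    #leaf     : count leaf role ≡ L
    #tip      : count tip role ≡ T

  open Labelling labelling public

Newest : ∀ {n da db dc L T} → Role → Stage (suc n) da db dc L T → Set
Newest r s = role zero ≡ r × graph a zero ≡ true
  where open Stage s

triangle : Stage 3 2 2 2 0 0
triangle = record
  { graph = K3 ; a = zero ; b = suc zero ; c = suc (suc zero) ; role = λ _ → core
  ; labelling = Labelling-K3
  ; deg-a = refl ; deg-b = refl ; deg-c = refl
  ; #core = refl ; #leaf = refl ; #tip = refl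
  }

rotate : ∀ {n da db dc L T} → Stage n da db dc L T → Stage n db dc da L T
rotate s = record
  { graph = graph ; a = b ; b = c ; c = a ; role = role
  ; labelling = Labelling-rotate labelling
  ; deg-a = deg-b ; deg-b = deg-c ; deg-c = deg-a
  ; #core = #core ; #leaf = #leaf ; #tip = #tip
  }
  where open Stage s

addLeaf : ∀ {n da db dc L T} → Stage n da db dc L T → Σ (Stage (suc n) (suc da) (suc db) dc (suc L) T) (Newest leaf)
addLeaf s = record
  { graph = addVertex graph a b ; a = suc a ; b = suc b ; c = suc c ; role = leaf ∷ role
  ; labelling = AddLeaf.labelling labelling
  ; deg-a = trans (deg-addVertex-u graph a b) (cong suc deg-a)
  ; deg-b = trans (deg-addVertex-v graph a b) (cong suc deg-b)
  ; deg-c = trans (deg-addVertex-other graph a b c≢a (b≢c ∘ sym)) deg-c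
  ; #core = #core ; #leaf = cong suc #leaf ; #tip = #tip
  }
  , refl , addVertex-adj-u graph a b
  where open Stage s

-- Writing the counts as δ leaf r + L and δ tip r + T lets one statement cover extending a
-- leaf (r = leaf) and extending a tip (r = tip).
extend : ∀ {n da db dc L T r} → Degree2 r → (s : Stage (suc n) da db dc (δ leaf r + L) (δ tip r + T)) →
         Newest r s → Σ (Stage (suc (suc n)) (suc da) db dc L (suc T)) (Newest tip)
extend {r = r} two s (role₀ , a~0) = record
  { graph = addVertex graph a zero ; a = suc a ; b = suc b ; c = suc c ; role = tip ∷ mid ∷ tail role
  ; labelling = Extend.labelling labelling role₀ two a~0
  ; deg-a = trans (deg-addVertex-u graph a zero) (cong suc deg-a)
  ; deg-b = trans (deg-addVertex-other graph a zero (a≢b ∘ sym) (tail≢core role₀≢core role-b ∘ sym)) deg-b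
  ; deg-c = trans (deg-addVertex-other graph a zero c≢a (tail≢core role₀≢core role-c ∘ sym)) deg-c
  ; #core = trans (cong (_+ count core (tail role)) (sym (δ-core-degree2 two))) (trans (count-tail core) #core)
  ; #leaf = +-cancelˡ-≡ (δ leaf r) _ _ (trans (count-tail leaf) #leaf)
  ; #tip  = cong suc (+-cancelˡ-≡ (δ tip r) _ _ (trans (count-tail tip) #tip))
  }
  , refl , addVertex-adj-u graph a zero
  where
  open Stage s
  open Extend labelling role₀ two a~0 using (role₀≢core)

  count-tail : ∀ x → δ x r + count x (tail role) ≡ count x role
  count-tail x = cong (λ y → δ x y + count x (tail role)) (sym role₀)

leaves : ∀ s {n da db dc L T} → Stage n da db dc L T → Stage (s + n) (s + da) (s + db) dc (s + L) T
leaves zero    st = st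
leaves (suc s) st = proj₁ (addLeaf (leaves s st))

tips : ∀ k {n da db dc L T} → Σ (Stage (suc n) da db dc L (suc T)) (Newest tip) →
       Σ (Stage (suc (k + n)) (k + da) db dc L (suc T)) (Newest tip)
tips zero    p = p
tips (suc k) p = uncurry (extend tip) (tips k p)

fan : ∀ k {n da db dc L T} → Stage n da db dc L T → Stage (suc (k + suc n)) (k + suc (suc da)) (suc db) dc L (suc T)
fan k st = proj₁ (tips k (uncurry (extend leaf) (addLeaf st)))

fans : ∀ t {n da db dc L T} → Stage n da db dc L T → Stage (t * 2 + n) (t * 2 + da) (t + db) dc L (t + T)
fans zero    st = st
fans (suc t) st = fan 0 (fans t st)

arm : ∀ s t R {n da db dc L T} → Stage n da db dc L T →
      Stage (suc (R + suc (t * 2 + (s + n)))) (R + suc (suc (t * 2 + (s + da)))) (suc (t + (s + db))) dc (s + L) (suc (t + T))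
arm s t R st = fan R (fans t (leaves s st))

castStage : ∀ {n da db dc L T n′ da′ db′ dc′ L′ T′} →
            n ≡ n′ → da ≡ da′ → db ≡ db′ → dc ≡ dc′ → L ≡ L′ → T ≡ T′ →
            Stage n da db dc L T → Stage n′ da′ db′ dc′ L′ T′
castStage refl refl refl refl refl refl st = st

BalancedStage : ℕ → ℕ → ℕ → Set
BalancedStage n L T = Σ ℕ λ k → Stage n (4 + k) (4 + k) (4 + k) L T

balanced : ∀ s t R → BalancedStage ((3 + s + t * 2 + R) * 3) (s * 3) (suc t * 3)
balanced s t R = suc (s * 2 + t * 3 + R)
  , castStage (size s t R) (deg₁ s t R) (deg₂ s t R) (deg₂ s t R) (#leaves s) (#tips t)
      (rotate (arm s t R (rotate (arm s t R (rotate (arm s t R triangle))))))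
  where
  size : ∀ s t R → suc (R + suc (t * 2 + (s + suc (R + suc (t * 2 + (s + suc (R + suc (t * 2 + (s + 3)))))))))
                   ≡ (3 + s + t * 2 + R) * 3
  size = solve-∀
  deg₁ : ∀ s t R → suc (t + (s + (R + suc (suc (t * 2 + (s + 2)))))) ≡ 5 + (s * 2 + t * 3 + R)
  deg₁ = solve-∀
  deg₂ : ∀ s t R → R + suc (suc (t * 2 + (s + suc (t + (s + 2))))) ≡ 5 + (s * 2 + t * 3 + R)
  deg₂ = solve-∀
  #leaves : ∀ s → s + (s + (s + 0)) ≡ s * 3
  #leaves = solve-∀
  #tips : ∀ t → suc (t + suc (t + suc (t + 0))) ≡ suc t * 3
  #tips = solve-∀

roleDegree : ℕ → Role → ℕ
roleDegree Δ core = Δ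
roleDegree _ r    = tailDegree r

module _ (k : ℕ) where
  private Δ = 4 + k

  roleDegree≤Δ : ∀ r → roleDegree Δ r ≤ Δ
  roleDegree≤Δ core = ≤-reflexive refl
  roleDegree≤Δ mid  = s≤s (s≤s (s≤s z≤n))
  roleDegree≤Δ leaf = s≤s (s≤s z≤n)
  roleDegree≤Δ tip  = s≤s (s≤s z≤n)

  roleDegree≡Δ : ∀ r → roleDegree Δ r ≡ Δ → r ≡ core
  roleDegree≡Δ core _ = refl

  roleDegree≢Δ : ∀ r → roleDegree Δ r ≢ Δ → roleDegree Δ r ≡ 2 ⊎ roleDegree Δ r ≡ 3
  roleDegree≢Δ core ≢Δ = ⊥-elim (≢Δ refl)
  roleDegree≢Δ mid  _  = inj₂ refl
  roleDegree≢Δ leaf _  = inj₁ refl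
  roleDegree≢Δ tip  _  = inj₁ refl

  𝟙-roleDegree≟Δ : ∀ r → 𝟙 ⌊ roleDegree Δ r ℕ.≟ Δ ⌋ ≡ δ core r
  𝟙-roleDegree≟Δ core = cong 𝟙 (⌊⌋-yes (Δ ℕ.≟ Δ) refl)
  𝟙-roleDegree≟Δ mid  = cong 𝟙 (⌊⌋-no (3 ℕ.≟ Δ) λ ())
  𝟙-roleDegree≟Δ leaf = cong 𝟙 (⌊⌋-no (2 ℕ.≟ Δ) λ ())
  𝟙-roleDegree≟Δ tip  = cong 𝟙 (⌊⌋-no (2 ℕ.≟ Δ) λ ())

  𝟙-roleDegree≡ᵇ2 : ∀ r → 𝟙 (roleDegree Δ r ≡ᵇ 2) ≡ δ leaf r + δ tip r
  𝟙-roleDegree≡ᵇ2 core = refl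
  𝟙-roleDegree≡ᵇ2 mid  = refl
  𝟙-roleDegree≡ᵇ2 leaf = refl
  𝟙-roleDegree≡ᵇ2 tip  = refl

module Balanced {n L T} (bst : BalancedStage n L T) where
  private
    k = proj₁ bst
    Δ = 4 + k
  open Stage (proj₂ bst)

  deg-role : ∀ i → deg graph i ≡ roleDegree Δ (role i)
  deg-role i with role i in eq
  ... | core = [ (λ { refl → deg-a }) , [ (λ { refl → deg-b }) , (λ { refl → deg-c }) ] ] (core-abc i eq)
  ... | mid  = tail-deg-≡ eq λ ()
  ... | leaf = tail-deg-≡ eq λ ()
  ... | tip  = tail-deg-≡ eq λ ()

  maxDeg≡Δ : maxDeg graph ≡ Δ
  maxDeg≡Δ = maxDeg-attained graph (λ j → subst (_≤ Δ) (sym (deg-role j)) (roleDegree≤Δ k (role j))) a deg-a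

  deg≡maxDeg⇒core : ∀ i → deg graph i ≡ maxDeg graph → role i ≡ core
  deg≡maxDeg⇒core i d = roleDegree≡Δ k (role i) (trans (sym (deg-role i)) (trans d maxDeg≡Δ))

  coreSize≡3 : coreSize graph ≡ 3
  coreSize≡3 = begin
    coreSize graph                                  ≡⟨ sumList-allFin (λ i → 𝟙 ⌊ deg graph i ℕ.≟ maxDeg graph ⌋) ⟩
    ∑[ i < n ] 𝟙 ⌊ deg graph i ℕ.≟ maxDeg graph ⌋   ≡⟨ sum-cong-≗ core-term ⟩
    count core role                                 ≡⟨ #core ⟩
    3                                               ∎
    where
    open ≡-Reasoning
    core-term : ∀ i → 𝟙 ⌊ deg graph i ℕ.≟ maxDeg graph ⌋ ≡ δ core (role i)
    core-term i = trans (cong₂ (λ d m → 𝟙 ⌊ d ℕ.≟ m ⌋) (deg-role i) maxDeg≡Δ) (𝟙-roleDegree≟Δ k (role i))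

  tailDeg23 : TailDeg23 graph
  tailDeg23 i ≢max = subst (λ d → d ≡ 2 ⊎ d ≡ 3) (sym (deg-role i))
    (roleDegree≢Δ k (role i) λ e → ≢max (trans (deg-role i) (trans e (sym maxDeg≡Δ))))

  good : Good graph
  good = (graph , built , ↔-id _ , λ _ _ → refl)
       , (coreSize≡3 , λ i j dᵢ dⱼ → core-adj i j (deg≡maxDeg⇒core i dᵢ) (deg≡maxDeg⇒core j dⱼ))
       , tailDeg23

  deg2Count≡ : deg2Count graph ≡ L + T
  deg2Count≡ = begin
    deg2Count graph                                ≡⟨ sum-cong-≗ deg2-term ⟩
    ∑[ i < n ] (δ leaf (role i) + δ tip (role i))  ≡⟨ ∑-distrib-+ (δ leaf ∘ role) (δ tip ∘ role) ⟩
    count leaf role + count tip role               ≡⟨ cong₂ _+_ #leaf #tip ⟩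
    L + T                                          ∎
    where
    open ≡-Reasoning
    deg2-term : ∀ i → 𝟙 (deg graph i ≡ᵇ 2) ≡ δ leaf (role i) + δ tip (role i)
    deg2-term i = trans (cong (λ d → 𝟙 (d ≡ᵇ 2)) (deg-role i)) (𝟙-roleDegree≡ᵇ2 k (role i))

  no-deg3-neighbour : ∀ i → role i ≡ leaf → deg3Neighbours graph i ≡ 0
  no-deg3-neighbour i leafᵢ = sum-zero term
    where
    term : ∀ j → 𝟙 (graph i j ∧ (deg graph j ≡ᵇ 3)) ≡ 0
    term j with graph i j in i~j
    ... | false = refl
    ... | true rewrite deg-role j | leaf-adj i j leafᵢ i~j = refl

  has-deg3-neighbour : ∀ i → role i ≡ tip → 1 ≤ deg3Neighbours graph i
  has-deg3-neighbour i tipᵢ with tip-adj i tipᵢ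
  ... | j , i~j , midⱼ = subst (_≤ deg3Neighbours graph i) term≡1 (≤-sum (λ j → 𝟙 (graph i j ∧ (deg graph j ≡ᵇ 3))) j)
    where
    term≡1 : 𝟙 (graph i j ∧ (deg graph j ≡ᵇ 3)) ≡ 1
    term≡1 rewrite i~j | deg-role j | midⱼ = refl

  leafCount≡ : leafCount graph ≡ L
  leafCount≡ = trans (sum-cong-≗ term) #leaf
    where
    term : ∀ i → 𝟙 ((deg graph i ≡ᵇ 2) ∧ (deg3Neighbours graph i ≡ᵇ 0)) ≡ δ leaf (role i)
    term i rewrite deg-role i with role i in eq
    ... | core = refl
    ... | mid  = refl
    ... | leaf rewrite no-deg3-neighbour i eq = refl
    ... | tip  with deg3Neighbours graph i | has-deg3-neighbour i eq
    ...   | suc _ | _ = refl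

length-cartesianProduct : ∀ {A B : Set} (xs : List A) (ys : List B) →
                          length (cartesianProduct xs ys) ≡ length xs * length ys
length-cartesianProduct List.[]         ys = refl
length-cartesianProduct (x List.∷ xs) ys =
  trans (length-++ (map (x ,_) ys)) (cong₂ _+_ (length-map (x ,_) ys) (length-cartesianProduct xs ys))

N3≥-≤ : ∀ {n k k′} → k ≤ k′ → N3≥ n k′ → N3≥ n k
N3≥-≤ {k = k} k≤k′ (Gs , len , good , noniso) =
  take k Gs , trans (length-take k Gs) (trans (cong (k ℕ.⊓_) len) (m≤n⇒m⊓n≡m k≤k′)) ,
  All.take⁺ k good , AllPairs.take⁺ k noniso

module Family (S T : ℕ) where

  fits : ∀ s t → s ℕ.< S → t ℕ.< T → 3 + s + t * 2 ≤ S + T * 2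
  fits s t s<S t<T = ≤-trans (≤-reflexive (regroup s t)) (+-mono-≤ s<S (*-monoˡ-≤ 2 t<T))
    where
    regroup : ∀ s t → 3 + s + t * 2 ≡ suc s + suc t * 2
    regroup = solve-∀

  stage : (i : Fin S) (j : Fin T) → BalancedStage ((S + T * 2) * 3) (toℕ i * 3) (suc (toℕ j) * 3)
  stage i j = subst (λ m → BalancedStage (m * 3) (toℕ i * 3) (suc (toℕ j) * 3))
                    (m+[n∸m]≡n (fits (toℕ i) (toℕ j) (toℕ<n i) (toℕ<n j)))
                    (balanced (toℕ i) (toℕ j) _)

  member : Fin S × Fin T → Graph ((S + T * 2) * 3)
  member (i , j) = Stage.graph (proj₂ (stage i j))

  member-injective : ∀ {x y} → member x ≅ member y → x ≡ y
  member-injective {i , j} {i′ , j′} iso = cong₂ _,_ (toℕ-injective s≡s′) (toℕ-injective t≡t′)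
    where
    s≡s′ : toℕ i ≡ toℕ i′
    s≡s′ = *-cancelʳ-≡ (toℕ i) (toℕ i′) 3
      (trans (sym (Balanced.leafCount≡ (stage i j))) (trans (leafCount-≅ iso) (Balanced.leafCount≡ (stage i′ j′))))
    deg2 : toℕ i * 3 + suc (toℕ j) * 3 ≡ toℕ i * 3 + suc (toℕ j′) * 3
    deg2 = trans (sym (Balanced.deg2Count≡ (stage i j)))
             (trans (deg2Count-≅ iso) (trans (Balanced.deg2Count≡ (stage i′ j′)) (cong (λ s → s * 3 + _) (sym s≡s′))))
    t≡t′ : toℕ j ≡ toℕ j′
    t≡t′ = cong ℕ.pred (*-cancelʳ-≡ (suc (toℕ j)) (suc (toℕ j′)) 3 (+-cancelˡ-≡ (toℕ i * 3) _ _ deg2))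

  indices : List (Fin S × Fin T)
  indices = cartesianProduct (allFin S) (allFin T)

  N3≥-family : N3≥ ((S + T * 2) * 3) (S * T)
  N3≥-family = map member indices
    , trans (length-map member indices)
        (trans (length-cartesianProduct (allFin S) (allFin T)) (cong₂ _*_ (length-tabulate {n = S} id) (length-tabulate {n = T} id)))
    , All.map⁺ (All.universal (λ (i , j) → Balanced.good (stage i j)) indices)
    , AllPairs.map⁺ (AllPairs.map (_∘ member-injective) (cartesianProduct⁺ (allFin⁺ S) (allFin⁺ T)))

module Quarter (m : ℕ) where
  T : ℕ
  T = m / 4

  S : ℕ
  S = m % 4 + T * 2

  m≡m%4+T*4 : m ≡ m % 4 + T * 4
  m≡m%4+T*4 = m≡m%n+[m/n]*n m 4

  m≡S+T*2 : m ≡ S + T * 2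
  m≡S+T*2 = trans m≡m%4+T*4 (regroup (m % 4) T)
    where
    regroup : ∀ r t → r + t * 4 ≡ r + t * 2 + t * 2
    regroup = solve-∀

  T*2≤S : T * 2 ≤ S
  T*2≤S = m≤n+m (T * 2) (m % 4)

  N3≥-quarter : N3≥ (m * 3) (S * T)
  N3≥-quarter = subst (λ x → N3≥ (x * 3) (S * T)) (sym m≡S+T*2) (Family.N3≥-family S T)

  [m*3∸15]^2/72≤S*T : (m * 3 ∸ 15) ^ 2 / 72 ≤ S * T
  [m*3∸15]^2/72≤S*T = ≤-trans (/-monoˡ-≤ 72 square-bound) (≤-reflexive (m*n/n≡m (S * T) 72))
    where
    open ≤-Reasoning
    m%4≤5 : m % 4 ≤ 5
    m%4≤5 = <⇒≤ (≤-trans (m%n<n m 4) (m≤m+n 4 1))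
    m∸5≤T*4 : m ∸ 5 ≤ T * 4
    m∸5≤T*4 = m≤n+o⇒m∸n≤o m 5 (≤-trans (≤-reflexive m≡m%4+T*4) (+-monoˡ-≤ (T * 4) m%4≤5))
    regroup : ∀ t → (t * 4 * 3) * ((t * 4 * 3) * 1) ≡ t * 2 * t * 72
    regroup = solve-∀
    square-bound : (m * 3 ∸ 15) ^ 2 ≤ S * T * 72
    square-bound = begin
      (m * 3 ∸ 15) ^ 2   ≡⟨ cong (_^ 2) (sym (*-distribʳ-∸ 3 m 5)) ⟩
      ((m ∸ 5) * 3) ^ 2  ≤⟨ ^-monoˡ-≤ 2 (*-monoˡ-≤ 3 m∸5≤T*4) ⟩
      (T * 4 * 3) ^ 2    ≡⟨ regroup T ⟩
      T * 2 * T * 72     ≤⟨ *-monoˡ-≤ 72 (*-monoˡ-≤ T T*2≤S) ⟩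
      S * T * 72         ∎

  [m*3]^2≤144*S*T : 4 ≤ m → (m * 3) ^ 2 ≤ 144 * (S * T)
  [m*3]^2≤144*S*T 4≤m = begin
    (m * 3) ^ 2              ≡⟨ regroup₁ m ⟩
    9 * (m * m)              ≤⟨ *-monoʳ-≤ 9 (*-mono-≤ m≤S+S m≤T*8) ⟩
    9 * ((S + S) * (T * 8))  ≡⟨ regroup₂ S T ⟩
    144 * (S * T)            ∎
    where
    open ≤-Reasoning
    regroup₁ : ∀ x → (x * 3) * ((x * 3) * 1) ≡ 9 * (x * x)
    regroup₁ = solve-∀
    regroup₂ : ∀ x y → 9 * ((x + x) * (y * 8)) ≡ 144 * (x * y)
    regroup₂ = solve-∀
    doubled : ∀ t → t * 4 + t * 4 ≡ t * 8
    doubled = solve-∀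
    m≤S+S : m ≤ S + S
    m≤S+S = ≤-trans (≤-reflexive m≡S+T*2) (+-monoʳ-≤ S T*2≤S)
    m%4≤T*4 : m % 4 ≤ T * 4
    m%4≤T*4 = <⇒≤ (≤-trans (m%n<n m 4) (*-monoˡ-≤ 4 (m≥n⇒m/n>0 4≤m)))
    m≤T*8 : m ≤ T * 8
    m≤T*8 = ≤-trans (≤-reflexive m≡m%4+T*4) (≤-trans (+-monoˡ-≤ (T * 4) m%4≤T*4) (≤-reflexive (doubled T)))

theorem5p5 : (Σ ℕ λ q → q ≥ 1 × (Σ ℕ λ N₀ → ∀ n → n ≥ N₀ → 3 ∣ n → Σ ℕ λ k → N3≥ n k × n ^ 2 ≤ q * k))
    × (∀ n → n ≥ 24 → 3 ∣ n → N3≥ n (((n ∸ 15) ^ 2) / 72))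
theorem5p5 = (144 , s≤s z≤n , 12 , quadratic) , floor-bound
  where
  quadratic : ∀ n → n ≥ 12 → 3 ∣ n → Σ ℕ λ k → N3≥ n k × n ^ 2 ≤ 144 * k
  quadratic .(m * 3) n≥12 (divides m refl) = S * T , N3≥-quarter , [m*3]^2≤144*S*T (*-cancelʳ-≤ 4 m 3 n≥12)
    where open Quarter m

  -- The bound holds for every multiple of 3; below 24 it is 0.
  floor-bound : ∀ n → n ≥ 24 → 3 ∣ n → N3≥ n (((n ∸ 15) ^ 2) / 72)
  floor-bound .(m * 3) _ (divides m refl) = N3≥-≤ [m*3∸15]^2/72≤S*T N3≥-quarter
    where open Quarter m
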